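{- Suppose that for some positive integer $s$ there exists an arrangement of $s$ distinct lines in $\mathbb{P}^2(\mathbb{K})$, for some field $\mathbb{K}$, in which every intersection point is a triple point (i.e. a realizable Steiner triple system on $s$ lines). Then $T_3(s-1)=U_3(s-1)$, i.e. there exists an arrangement of $s-1$ lines whose number of triple points attains the Schönheim bound.
   Context: For a line arrangement $\mathcal{L}$ (a finite set of distinct lines in $\mathbb{P}^2(\mathbb{K})$ over a field $\mathbb{K}$), $t_3(\mathcal{L})$ denotes the number of points lying on exactly three lines of $\mathcal{L}$; an intersection point is a point lying on at least two lines. $T_3(n)=\max_{\mathcal{L}} t_3(\mathcal{L})$, the maximum over all arrangements of $n$ lines over all fields. The Schönheim bound is $U_3(n)=\left\lfloor\left\lfloor\frac{n-1}{2}\right\rfloor\frac{n}{3}\right\rfloor-\varepsilon(n)$, where $\varepsilon(n)=1$ if $n\equiv 5\pmod 6$ and $\varepsilon(n)=0$ otherwise; it satisfies $T_3(n)\le U_3(n)$. -}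

module Defs where

open import Level using (Level; _⊔_) renaming (suc to lsuc)
open import Algebra.Bundles using (CommutativeRing)
open import Data.Nat using (ℕ; _∸_; _≡ᵇ_)
import Data.Nat as ℕ
open import Data.Nat.DivMod using (_/_; _%_)
open import Data.Bool using (if_then_else_)
open import Data.Fin using (Fin) renaming (_<_ to _<ᶠ_)
open import Data.Product using (Σ; ∃; _×_; _,_; proj₁)
open import Data.Sum using (_⊎_)
open import Relation.Binary.PropositionalEquality using (_≡_; _≢_)
open import Relation.Nullary using (¬_)

record Field (c ℓ : Level) : Set (lsuc (c ⊔ ℓ)) where
  field
    commutativeRing : CommutativeRing c ℓ
  open CommutativeRing commutativeRing public
  field
    0≉1     : ¬ (0# ≈ 1#)
    inverse : ∀ x → ¬ (x ≈ 0#) → ∃ λ y → (x * y) ≈ 1#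

module Projective {c ℓ : Level} (F : Field c ℓ) where
  open Field F

  Vec3 : Set c
  Vec3 = Carrier × Carrier × Carrier

  NonzeroVec : Vec3 → Set ℓ
  NonzeroVec (x , y , z) = ¬ ((x ≈ 0#) × (y ≈ 0#) × (z ≈ 0#))

  Proportional : Vec3 → Vec3 → Set (c ⊔ ℓ)
  Proportional (x , y , z) (x' , y' , z') =
    ∃ λ k → ¬ (k ≈ 0#) × (x' ≈ (k * x)) × (y' ≈ (k * y)) × (z' ≈ (k * z))

  -- points and lines of P^2(K), given by nonzero coordinate vectors
  -- (equality of points/lines is Proportional on their coordinates)
  Point : Set (c ⊔ ℓ)
  Point = Σ Vec3 NonzeroVec

  Line : Set (c ⊔ ℓ)
  Line = Σ Vec3 NonzeroVec

  SamePoint : Point → Point → Set (c ⊔ ℓ)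
  SamePoint p q = Proportional (proj₁ p) (proj₁ q)

  SameLine : Line → Line → Set (c ⊔ ℓ)
  SameLine L M = Proportional (proj₁ L) (proj₁ M)

  _∈ᴸ_ : Point → Line → Set ℓ
  ((x , y , z) , _) ∈ᴸ ((a , b , c') , _) = (((a * x) + (b * y)) + (c' * z)) ≈ 0#

record Arrangement {c ℓ : Level} (F : Field c ℓ) (n : ℕ) : Set (c ⊔ ℓ) where
  open Projective F
  field
    line     : Fin n → Line
    distinct : ∀ i j → i ≢ j → ¬ SameLine (line i) (line j)

module _ {c ℓ : Level} {F : Field c ℓ} {n : ℕ} (A : Arrangement F n) where
  open Projective F
  open Arrangement A

  IntersectionPoint : Point → Set ℓ
  IntersectionPoint p = ∃ λ i → ∃ λ j → i ≢ j × (p ∈ᴸ line i) × (p ∈ᴸ line j)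

  TriplePoint : Point → Set ℓ
  TriplePoint p = ∃ λ i → ∃ λ j → ∃ λ k → (i <ᶠ j) × (j <ᶠ k)
    × (p ∈ᴸ line i) × (p ∈ᴸ line j) × (p ∈ᴸ line k)
    × (∀ m → p ∈ᴸ line m → (m ≡ i) ⊎ (m ≡ j) ⊎ (m ≡ k))

  AllIntersectionsTriple : Set (c ⊔ ℓ)
  AllIntersectionsTriple = ∀ p → IntersectionPoint p → TriplePoint p

  HasT3 : ℕ → Set (c ⊔ ℓ)
  HasT3 t = ∃ λ (ps : Fin t → Point) →
      (∀ a b → a ≢ b → ¬ SamePoint (ps a) (ps b))
    × (∀ a → TriplePoint (ps a))
    × (∀ p → TriplePoint p → ∃ λ a → SamePoint p (ps a))

ε : ℕ → ℕ
ε n = if (n % 6) ≡ᵇ 5 then 1 else 0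

U3 : ℕ → ℕ
U3 n = (((n ∸ 1) / 2) ℕ.* n) / 3 ∸ ε n

-- Delete one line ℓ from an arrangement of n + 1 lines in which every intersection point is a
-- triple point; the triple points of the remaining n lines are the old triple points off ℓ.
-- Two lines i ≠ j meet in a point lying on exactly one further line i · j, and with i · i = i
-- this is a Steiner quasigroup: i · j = j · i and i · (i · j) = j.  For each remaining line i
-- exactly n − 2 remaining lines j have i · j ≠ ℓ, and every surviving block {i, j, i · j} is
-- counted by six such ordered pairs, so 6 t = n (n − 2).  This forces n to be even (or n = 1),
-- and for even n the number n (n − 2) / 6 is the Schönheim bound U₃(n).
module Submission where

open import Level using (Level)
open import Defs

module Counting where
  open import Data.Nat using (ℕ; zero; suc; _+_; _*_; _≤_; z≤n)
  open import Data.Nat.Properties using (+-0-commutativeMonoid; +-assoc; *-zeroʳ; +-mono-≤)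
  open import Data.Fin using (Fin; zero; suc; _↑ˡ_; _↑ʳ_; combine; remQuot)
  open import Data.Fin.Properties using (_≟_; suc-injective; remQuot-combine; combine-remQuot)
  open import Data.Fin.Permutation using (permutation)
  open import Data.Product using (∃; _,_; uncurry)
  open import Data.Sum using (_⊎_; inj₁; inj₂)
  open import Function using (_∘_; id)
  open import Level using (_⊔_)
  open import Relation.Binary.PropositionalEquality
  open import Relation.Nullary using (Dec; yes; no; ¬_; contradiction)
  open import Relation.Nullary.Decidable using (_⊎-dec_)
  open import Algebra.Properties.CommutativeMonoid.Sum +-0-commutativeMonoid
    using (sum; sum-syntax; ∑-permute; sum-cong-≗)

  iverson : ∀ {p} {P : Set p} → Dec P → ℕ
  iverson (yes _) = 1
  iverson (no _)  = 0

  iverson-yes : ∀ {p} {P : Set p} (P? : Dec P) → P → iverson P? ≡ 1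
  iverson-yes (yes _) _  = refl
  iverson-yes (no ¬p) p = contradiction p ¬p

  iverson-no : ∀ {p} {P : Set p} (P? : Dec P) → ¬ P → iverson P? ≡ 0
  iverson-no (yes p) ¬p = contradiction p ¬p
  iverson-no (no _)  _  = refl

  iverson-⇔ : ∀ {p q} {P : Set p} {Q : Set q} → (P → Q) → (Q → P) →
              (P? : Dec P) (Q? : Dec Q) → iverson P? ≡ iverson Q?
  iverson-⇔ to from (yes p) Q? = sym (iverson-yes Q? (to p))
  iverson-⇔ to from (no ¬p) Q? = sym (iverson-no Q? (¬p ∘ from))

  iverson-⊎ : ∀ {p q r} {P : Set p} {Q : Set q} {R : Set r} →
              (P → Q ⊎ R) → (Q → P) → (R → P) → (Q → ¬ R) →
              (P? : Dec P) (Q? : Dec Q) (R? : Dec R) → iverson P? ≡ iverson Q? + iverson R?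
  iverson-⊎ split fromQ fromR disjoint (yes p) Q? R? with split p
  ... | inj₁ q = sym (cong₂ _+_ (iverson-yes Q? q) (iverson-no R? (disjoint q)))
  ... | inj₂ r = sym (cong₂ _+_ (iverson-no Q? (λ q → disjoint q r)) (iverson-yes R? r))
  iverson-⊎ split fromQ fromR disjoint (no ¬p) Q? R? =
    sym (cong₂ _+_ (iverson-no Q? (¬p ∘ fromQ)) (iverson-no R? (¬p ∘ fromR)))

  iverson-⊎₃ : ∀ {p q r t} {P : Set p} {Q : Set q} {R : Set r} {S : Set t} →
               (P → Q ⊎ R ⊎ S) → (Q ⊎ R ⊎ S → P) → (Q → ¬ R) → (Q → ¬ S) → (R → ¬ S) →
               (P? : Dec P) (Q? : Dec Q) (R? : Dec R) (S? : Dec S) →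
               iverson P? ≡ iverson Q? + (iverson R? + iverson S?)
  iverson-⊎₃ {Q = Q} {R} {S} split join Q∩R Q∩S R∩S P? Q? R? S? =
    trans (iverson-⊎ split (join ∘ inj₁) (join ∘ inj₂) Q∩R∪S P? Q? (R? ⊎-dec S?))
          (cong (iverson Q? +_) (iverson-⊎ id inj₁ inj₂ R∩S (R? ⊎-dec S?) R? S?))
    where
    Q∩R∪S : Q → ¬ (R ⊎ S)
    Q∩R∪S q (inj₁ r) = Q∩R q r
    Q∩R∪S q (inj₂ s) = Q∩S q s

  ∑-cong : ∀ {m} {f g : Fin m → ℕ} → (∀ i → f i ≡ g i) → ∑[ i < m ] f i ≡ ∑[ i < m ] g i
  ∑-cong = sum-cong-≗

  ∑-const : ∀ m k → ∑[ i < m ] k ≡ m * k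
  ∑-const zero    k = refl
  ∑-const (suc m) k = cong (k +_) (∑-const m k)

  ∑-mono-≤ : ∀ {m} {f g : Fin m → ℕ} → (∀ i → f i ≤ g i) → ∑[ i < m ] f i ≤ ∑[ i < m ] g i
  ∑-mono-≤ {zero}  f≤g = z≤n
  ∑-mono-≤ {suc m} f≤g = +-mono-≤ (f≤g zero) (∑-mono-≤ (f≤g ∘ suc))

  ∑-iverson-≡ : ∀ {m} (x : Fin m) → ∑[ y < m ] iverson (y ≟ x) ≡ 1
  ∑-iverson-≡ {suc m} zero = cong suc (trans (∑-cong others-absent) (trans (∑-const m 0) (*-zeroʳ m)))
    where
    others-absent : (y : Fin m) → iverson (suc y ≟ zero) ≡ 0
    others-absent y = iverson-no (suc y ≟ zero) λ ()
  ∑-iverson-≡ {suc m} (suc x) =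
    trans (∑-cong λ y → iverson-⇔ suc-injective (cong suc) (suc y ≟ suc x) (y ≟ x)) (∑-iverson-≡ x)

  ∑-involution : ∀ {m} (f : Fin m → ℕ) (φ : Fin m → Fin m) → (∀ x → φ (φ x) ≡ x) →
                 ∑[ i < m ] f (φ i) ≡ ∑[ i < m ] f i
  ∑-involution f φ φ∘φ≗id = sym (∑-permute f (permutation φ φ φ∘φ≗id φ∘φ≗id))

  ∑-↑ : ∀ a b (f : Fin (a + b) → ℕ) → sum f ≡ ∑[ i < a ] f (i ↑ˡ b) + ∑[ j < b ] f (a ↑ʳ j)
  ∑-↑ zero    b f = refl
  ∑-↑ (suc a) b f = trans (cong (f zero +_) (∑-↑ a b (f ∘ suc))) (sym (+-assoc (f zero) _ _))

  ∑-combine : ∀ m n (f : Fin (m * n) → ℕ) → sum f ≡ ∑[ i < m ] ∑[ j < n ] f (combine i j)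
  ∑-combine zero    n f = refl
  ∑-combine (suc m) n f =
    trans (∑-↑ n (m * n) f) (cong (∑[ j < n ] f (j ↑ˡ m * n) +_) (∑-combine m n (f ∘ (n ↑ʳ_))))

  count : ∀ {m p} {P : Fin m → Set p} → (∀ x → Dec (P x)) → ℕ
  count {m} P? = ∑[ x < m ] iverson (P? x)

  record Enumeration {a p} {A : Set a} (P : A → Set p) (c : ℕ) : Set (a ⊔ p) where
    field
      index     : Fin c → A
      sound     : ∀ k → P (index k)
      injective : ∀ k l → index k ≡ index l → k ≡ l
      complete  : ∀ x → P x → ∃ λ k → index k ≡ x

  module _ {m p} {P : Fin (suc m) → Set p} {c : ℕ} (rest : Enumeration (P ∘ suc) c) where
    open Enumeration rest

    include-zero : P zero → Enumeration P (suc c)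
    include-zero p0 = record { index = index′ ; sound = sound′ ; injective = injective′ ; complete = complete′ }
      where
      index′ : Fin (suc c) → Fin (suc m)
      index′ zero    = zero
      index′ (suc k) = suc (index k)
      sound′ : ∀ k → P (index′ k)
      sound′ zero    = p0
      sound′ (suc k) = sound k
      injective′ : ∀ k l → index′ k ≡ index′ l → k ≡ l
      injective′ zero    zero    _  = refl
      injective′ (suc k) (suc l) eq = cong suc (injective k l (suc-injective eq))
      complete′ : ∀ x → P x → ∃ λ k → index′ k ≡ x
      complete′ zero    _  = zero , refl
      complete′ (suc x) px = let k , eq = complete x px in suc k , cong suc eq

    exclude-zero : ¬ P zero → Enumeration P c
    exclude-zero ¬p0 = record { index = suc ∘ index ; sound = sound
                              ; injective = λ k l → injective k l ∘ suc-injective ; complete = complete′ }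
      where
      complete′ : ∀ x → P x → ∃ λ k → suc (index k) ≡ x
      complete′ zero    p0 = contradiction p0 ¬p0
      complete′ (suc x) px = let k , eq = complete x px in k , cong suc eq

  enumerate : ∀ {m p} {P : Fin m → Set p} (P? : ∀ x → Dec (P x)) → Enumeration P (count P?)
  enumerate {zero}  P? = record { index = λ () ; sound = λ () ; injective = λ () ; complete = λ () }
  enumerate {suc m} P? with P? zero
  ... | yes p0 = include-zero (enumerate (P? ∘ suc)) p0
  ... | no ¬p0 = exclude-zero (enumerate (P? ∘ suc)) ¬p0

  enumerate₂ : ∀ {m n p} {P : Fin m → Fin n → Set p} (P? : ∀ i j → Dec (P i j)) →
               Enumeration (uncurry P) (∑[ i < m ] ∑[ j < n ] iverson (P? i j))
  enumerate₂ {m} {n} {P = P} P? = subst (Enumeration (uncurry P)) count≡∑∑ (record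
    { index     = remQuot n ∘ index
    ; sound     = sound
    ; injective = λ k l eq → injective k l (remQuot-injective eq)
    ; complete  = complete′ })
    where
    P′? : ∀ x → Dec (uncurry P (remQuot n x))
    P′? x = uncurry P? (remQuot n x)
    open Enumeration (enumerate P′?)
    remQuot-injective : ∀ {x y} → remQuot {m} n x ≡ remQuot n y → x ≡ y
    remQuot-injective {x} {y} eq = trans (sym (combine-remQuot {m} n x))
      (trans (cong (uncurry combine) eq) (combine-remQuot {m} n y))
    complete′ : ∀ ij → uncurry P ij → ∃ λ k → remQuot n (index k) ≡ ij
    complete′ (i , j) pij =
      let k , eq = complete (combine i j) (subst (uncurry P) (sym (remQuot-combine i j)) pij)
      in k , trans (cong (remQuot n) eq) (remQuot-combine i j)
    count≡∑∑ : count P′? ≡ ∑[ i < m ] ∑[ j < n ] iverson (P? i j)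
    count≡∑∑ = trans (∑-combine m n _)
      (∑-cong λ i → ∑-cong λ j → cong (λ ij → iverson (uncurry P? ij)) (remQuot-combine i j))

module Triples where
  open import Data.Nat using (ℕ; _<_; _≤_; _+_; _*_)
  open import Data.Nat.Properties
    using (≤-refl; <⇒≤; <-trans; <-irrefl; ≤-antisym; ≤-trans; ≤-reflexive; m≤m+n; m≤n+m; *-identityʳ; <⇒≱;
           module ≤-Reasoning; +-0-commutativeMonoid)
  open import Data.Fin using (Fin)
  open import Data.Fin.Properties using (_≟_; ¬∀⟶∃¬)
  open import Data.Product using (Σ; ∃; _×_; _,_)
  open import Data.Sum using (_⊎_; inj₁; inj₂)
  open import Function using (_∘_; id)
  open import Relation.Binary.PropositionalEquality
  open import Relation.Nullary using (¬_; contradiction)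
  open import Relation.Nullary.Decidable using (_⊎-dec_)
  open import Algebra.Properties.CommutativeMonoid.Sum +-0-commutativeMonoid using (sum; sum-syntax; ∑-distrib-+)
  open Counting

  _∈₃_ : ∀ {a} {A : Set a} → A → A × A × A → Set a
  t ∈₃ (x , y , z) = t ≡ x ⊎ t ≡ y ⊎ t ≡ z

  ∈₃-map : ∀ {a b} {A : Set a} {B : Set b} (f : A → B) {w x y z : A} →
           w ∈₃ (x , y , z) → f w ∈₃ (f x , f y , f z)
  ∈₃-map f (inj₁ refl)        = inj₁ refl
  ∈₃-map f (inj₂ (inj₁ refl)) = inj₂ (inj₁ refl)
  ∈₃-map f (inj₂ (inj₂ refl)) = inj₂ (inj₂ refl)

  ∈₃-swap₁₂ : ∀ {a} {A : Set a} {w x y z : A} → w ∈₃ (x , y , z) → w ∈₃ (y , x , z)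
  ∈₃-swap₁₂ (inj₁ w≡x)        = inj₂ (inj₁ w≡x)
  ∈₃-swap₁₂ (inj₂ (inj₁ w≡y)) = inj₁ w≡y
  ∈₃-swap₁₂ (inj₂ (inj₂ w≡z)) = inj₂ (inj₂ w≡z)

  ∈₃-swap₂₃ : ∀ {a} {A : Set a} {w x y z : A} → w ∈₃ (x , y , z) → w ∈₃ (x , z , y)
  ∈₃-swap₂₃ (inj₁ w≡x)        = inj₁ w≡x
  ∈₃-swap₂₃ (inj₂ (inj₁ w≡y)) = inj₂ (inj₂ w≡y)
  ∈₃-swap₂₃ (inj₂ (inj₂ w≡z)) = inj₂ (inj₁ w≡z)

  ∈₃-third : ∀ {a} {A : Set a} {w x y z : A} → w ∈₃ (x , y , z) → w ≢ x → w ≢ y → w ≡ z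
  ∈₃-third (inj₁ w≡x)        w≢x _   = contradiction w≡x w≢x
  ∈₃-third (inj₂ (inj₁ w≡y)) _   w≢y = contradiction w≡y w≢y
  ∈₃-third (inj₂ (inj₂ w≡z)) _   _   = w≡z

  third-of-three : ∀ {a} {A : Set a} {x y z i j : A} → x ≢ y → y ≢ z → x ≢ z →
                   i ∈₃ (x , y , z) → j ∈₃ (x , y , z) → i ≢ j →
                   Σ A λ t → t ∈₃ (x , y , z) × t ≢ i × t ≢ j × (∀ w → w ∈₃ (x , y , z) → w ∈₃ (i , j , t))
  third-of-three _ _ _ (inj₁ refl)        (inj₁ refl)        i≢i = contradiction refl i≢i
  third-of-three _ _ _ (inj₂ (inj₁ refl)) (inj₂ (inj₁ refl)) i≢i = contradiction refl i≢i
  third-of-three _ _ _ (inj₂ (inj₂ refl)) (inj₂ (inj₂ refl)) i≢i = contradiction refl i≢i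
  third-of-three {z = z} x≢y y≢z x≢z (inj₁ refl) (inj₂ (inj₁ refl)) _ =
    z , inj₂ (inj₂ refl) , ≢-sym x≢z , ≢-sym y≢z , λ _ → id
  third-of-three {z = z} x≢y y≢z x≢z (inj₂ (inj₁ refl)) (inj₁ refl) _ =
    z , inj₂ (inj₂ refl) , ≢-sym y≢z , ≢-sym x≢z , λ _ → ∈₃-swap₁₂
  third-of-three {y = y} x≢y y≢z x≢z (inj₁ refl) (inj₂ (inj₂ refl)) _ =
    y , inj₂ (inj₁ refl) , ≢-sym x≢y , y≢z , λ _ → ∈₃-swap₂₃
  third-of-three {y = y} x≢y y≢z x≢z (inj₂ (inj₂ refl)) (inj₁ refl) _ =
    y , inj₂ (inj₁ refl) , y≢z , ≢-sym x≢y , λ _ → ∈₃-swap₁₂ ∘ ∈₃-swap₂₃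
  third-of-three {x = x} x≢y y≢z x≢z (inj₂ (inj₁ refl)) (inj₂ (inj₂ refl)) _ =
    x , inj₁ refl , x≢y , x≢z , λ _ → ∈₃-swap₂₃ ∘ ∈₃-swap₁₂
  third-of-three {x = x} x≢y y≢z x≢z (inj₂ (inj₂ refl)) (inj₂ (inj₁ refl)) _ =
    x , inj₁ refl , x≢z , x≢y , λ _ → ∈₃-swap₁₂ ∘ ∈₃-swap₂₃ ∘ ∈₃-swap₁₂

  ascending-triples-agree : ∀ {a b c a′ b′ c′ : ℕ} → a < b → b < c → a′ < b′ → b′ < c′ →
    a′ ∈₃ (a , b , c) → b′ ∈₃ (a , b , c) → a ∈₃ (a′ , b′ , c′) → b ∈₃ (a′ , b′ , c′) → a ≡ a′ × b ≡ b′
  ascending-triples-agree {a} {b} {c} {a′} {b′} {c′} a<b b<c a′<b′ b′<c′ a′∈ b′∈ a∈ b∈ = a≡a′ , b≡b′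
    where
    least : ∀ {x y z w} → x < y → y < z → w ∈₃ (x , y , z) → x ≤ w
    least x<y y<z (inj₁ refl)        = ≤-refl
    least x<y y<z (inj₂ (inj₁ refl)) = <⇒≤ x<y
    least x<y y<z (inj₂ (inj₂ refl)) = <⇒≤ (<-trans x<y y<z)
    second : ∀ {x y z w} → x < y → y < z → x < w → w ∈₃ (x , y , z) → y ≤ w
    second x<y y<z x<w (inj₁ refl)        = contradiction x<w (<-irrefl refl)
    second x<y y<z x<w (inj₂ (inj₁ refl)) = ≤-refl
    second x<y y<z x<w (inj₂ (inj₂ refl)) = <⇒≤ y<z
    a≡a′ : a ≡ a′
    a≡a′ = ≤-antisym (least a<b b<c a′∈) (least a′<b′ b′<c′ a∈)
    b≡b′ : b ≡ b′
    b≡b′ = ≤-antisym (second a<b b<c (subst (_< b′) (sym a≡a′) a′<b′) b′∈)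
                     (second a′<b′ b′<c′ (subst (_< b) a≡a′ a<b) b∈)

  covered-by-three⇒≤3 : ∀ {s} {a b c : Fin s} → (∀ w → w ∈₃ (a , b , c)) → s ≤ 3
  covered-by-three⇒≤3 {s} {a} {b} {c} covered = begin
    s                                        ≡⟨ *-identityʳ s ⟨
    s * 1                                    ≡⟨ ∑-const s 1 ⟨
    ∑[ w < s ] 1                             ≤⟨ ∑-mono-≤ at-least-one ⟩
    ∑[ w < s ] (is a w + (is b w + is c w))  ≡⟨ ∑-distrib₃ ⟩
    sum (is a) + (sum (is b) + sum (is c))
      ≡⟨ cong₂ _+_ (∑-iverson-≡ a) (cong₂ _+_ (∑-iverson-≡ b) (∑-iverson-≡ c)) ⟩
    3                                        ∎
    where
    open ≤-Reasoning
    is : Fin s → Fin s → ℕ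
    is x w = iverson (w ≟ x)
    at-least-one : ∀ w → 1 ≤ is a w + (is b w + is c w)
    at-least-one w with covered w
    ... | inj₁ w≡a        = ≤-trans (≤-reflexive (sym (iverson-yes (w ≟ a) w≡a))) (m≤m+n (is a w) _)
    ... | inj₂ (inj₁ w≡b) = ≤-trans (≤-reflexive (sym (iverson-yes (w ≟ b) w≡b)))
                                    (≤-trans (m≤m+n (is b w) (is c w)) (m≤n+m _ (is a w)))
    ... | inj₂ (inj₂ w≡c) = ≤-trans (≤-reflexive (sym (iverson-yes (w ≟ c) w≡c)))
                                    (≤-trans (m≤n+m (is c w) (is b w)) (m≤n+m _ (is a w)))
    ∑-distrib₃ : ∑[ w < s ] (is a w + (is b w + is c w)) ≡ sum (is a) + (sum (is b) + sum (is c))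
    ∑-distrib₃ = trans (∑-distrib-+ (is a) _) (cong (sum (is a) +_) (∑-distrib-+ (is b) (is c)))

  outside-three : ∀ {s} → 3 < s → (a b c : Fin s) → ∃ λ w → ¬ w ∈₃ (a , b , c)
  outside-three {s} 3<s a b c = ¬∀⟶∃¬ s _ (λ w → w ≟ a ⊎-dec w ≟ b ⊎-dec w ≟ c) λ covered →
    <⇒≱ 3<s (covered-by-three⇒≤3 covered)

module SteinerQuasigroups where
  open import Data.Nat using (ℕ; suc; _+_; _*_; _∸_; _<_; _<?_; s≤s⁻¹) renaming (_≟_ to _≟ℕ_)
  open import Data.Nat.Properties
    using (<-irrefl; <-asym; <-trans; <-cmp; ≤∧≢⇒<; m+n∸n≡m; +-identityʳ; *-identityʳ; *-zeroʳ; *-distribʳ-+;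
           +-0-commutativeMonoid)
  open import Data.Fin using (Fin; toℕ; fromℕ; inject₁)
  open import Data.Fin.Properties using (_≟_; toℕ-injective; toℕ-fromℕ; toℕ-inject₁; toℕ<n)
  open import Data.Product using (_×_; _,_)
  open import Data.Sum using (_⊎_; inj₁; inj₂)
  open import Relation.Binary using (tri<; tri≈; tri>)
  open import Relation.Binary.PropositionalEquality
  open ≡-Reasoning
  open import Function using (_∘′_)
  open import Relation.Nullary using (Dec; yes; no; ¬_; contradiction)
  open import Relation.Nullary.Decidable using (_×-dec_; ¬?)
  open import Algebra.Properties.CommutativeMonoid.Sum +-0-commutativeMonoid
    using (sum; sum-syntax; ∑-comm; ∑-distrib-+; sum-init-last)
  open Counting

  record IsSteinerQuasigroup {m} (_·_ : Fin m → Fin m → Fin m) : Set where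
    field
      idem   : ∀ i → i · i ≡ i
      comm   : ∀ i j → i · j ≡ j · i
      cancel : ∀ i j → i · (i · j) ≡ j

    ·-≢ˡ : ∀ {i j} → i ≢ j → i · j ≢ i
    ·-≢ˡ {i} {j} i≢j eq = i≢j (sym (trans (sym (cancel i j)) (trans (cong (i ·_) eq) (idem i))))

    ·-≢ʳ : ∀ {i j} → i ≢ j → i · j ≢ j
    ·-≢ʳ {i} {j} i≢j eq = ·-≢ˡ (i≢j ∘′ sym) (trans (comm j i) eq)

  module BlocksAvoidingLast (n : ℕ) {_·_ : Fin (suc n) → Fin (suc n) → Fin (suc n)}
                            (isSteinerQuasigroup : IsSteinerQuasigroup _·_) where
    open IsSteinerQuasigroup isSteinerQuasigroup

    Ascending AscendingPair DistinctBelow : ℕ → ℕ → ℕ → Set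
    Ascending     a b c = a < b × b < c × c < n
    AscendingPair a b c = a < b × b < n × c < n
    DistinctBelow a b c = a ≢ b × a < n × b < n × c < n

    Ascending? : ∀ a b c → Dec (Ascending a b c)
    Ascending? a b c = a <? b ×-dec b <? c ×-dec c <? n

    AscendingPair? : ∀ a b c → Dec (AscendingPair a b c)
    AscendingPair? a b c = a <? b ×-dec b <? n ×-dec c <? n

    DistinctBelow? : ∀ a b c → Dec (DistinctBelow a b c)
    DistinctBelow? a b c = ¬? (a ≟ℕ b) ×-dec a <? n ×-dec b <? n ×-dec c <? n

    ⟦asc⟧ ⟦pair⟧ ⟦distinct⟧ : ℕ → ℕ → ℕ → ℕ
    ⟦asc⟧      a b c = iverson (Ascending? a b c)
    ⟦pair⟧     a b c = iverson (AscendingPair? a b c)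
    ⟦distinct⟧ a b c = iverson (DistinctBelow? a b c)

    distinct-split : ∀ a b c → ⟦distinct⟧ a b c ≡ ⟦pair⟧ a b c + ⟦pair⟧ b a c
    distinct-split a b c = iverson-⊎ split join₁ join₂ disjoint
      (DistinctBelow? a b c) (AscendingPair? a b c) (AscendingPair? b a c)
      where
      split : DistinctBelow a b c → AscendingPair a b c ⊎ AscendingPair b a c
      split (a≢b , a<n , b<n , c<n) with <-cmp a b
      ... | tri< a<b _ _ = inj₁ (a<b , b<n , c<n)
      ... | tri≈ _ a≡b _ = contradiction a≡b a≢b
      ... | tri> _ _ b<a = inj₂ (b<a , a<n , c<n)
      join₁ : AscendingPair a b c → DistinctBelow a b c
      join₁ (a<b , b<n , c<n) = (λ a≡b → <-irrefl a≡b a<b) , <-trans a<b b<n , b<n , c<n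
      join₂ : AscendingPair b a c → DistinctBelow a b c
      join₂ (b<a , a<n , c<n) = (λ a≡b → <-irrefl (sym a≡b) b<a) , a<n , <-trans b<a a<n , c<n
      disjoint : AscendingPair a b c → ¬ AscendingPair b a c
      disjoint (a<b , _) (b<a , _) = <-asym a<b b<a

    pair-split : ∀ {a b c} → (a ≢ b → c ≢ a × c ≢ b) → ⟦pair⟧ a b c ≡ ⟦asc⟧ a b c + (⟦asc⟧ a c b + ⟦asc⟧ c a b)
    pair-split {a} {b} {c} third-distinct = iverson-⊎₃ split join abc∩acb abc∩cab acb∩cab
      (AscendingPair? a b c) (Ascending? a b c) (Ascending? a c b) (Ascending? c a b)
      where
      split : AscendingPair a b c → Ascending a b c ⊎ Ascending a c b ⊎ Ascending c a b
      split (a<b , b<n , c<n) with third-distinct (λ a≡b → <-irrefl a≡b a<b) | <-cmp c a | <-cmp c b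
      ... | _           | tri< c<a _ _ | _            = inj₂ (inj₂ (c<a , a<b , b<n))
      ... | c≢a , _     | tri≈ _ c≡a _ | _            = contradiction c≡a c≢a
      ... | _ , c≢b     | tri> _ _ _   | tri≈ _ c≡b _ = contradiction c≡b c≢b
      ... | _           | tri> _ _ a<c | tri< c<b _ _ = inj₂ (inj₁ (a<c , c<b , b<n))
      ... | _           | tri> _ _ _   | tri> _ _ b<c = inj₁ (a<b , b<c , c<n)
      join : Ascending a b c ⊎ Ascending a c b ⊎ Ascending c a b → AscendingPair a b c
      join (inj₁ (a<b , b<c , c<n))        = a<b , <-trans b<c c<n , c<n
      join (inj₂ (inj₁ (a<c , c<b , b<n))) = <-trans a<c c<b , b<n , <-trans c<b b<n
      join (inj₂ (inj₂ (c<a , a<b , b<n))) = a<b , b<n , <-trans c<a (<-trans a<b b<n)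
      abc∩acb : Ascending a b c → ¬ Ascending a c b
      abc∩acb (_ , b<c , _) (_ , c<b , _) = <-asym b<c c<b
      abc∩cab : Ascending a b c → ¬ Ascending c a b
      abc∩cab (a<b , b<c , _) (c<a , _) = <-asym (<-trans a<b b<c) c<a
      acb∩cab : Ascending a c b → ¬ Ascending c a b
      acb∩cab (a<c , _) (c<a , _) = <-asym a<c c<a

    ∑∑ : (Fin (suc n) → Fin (suc n) → ℕ) → ℕ
    ∑∑ f = ∑[ i < suc n ] ∑[ j < suc n ] f i j

    ∑∑-cong : ∀ {f g} → (∀ i j → f i j ≡ g i j) → ∑∑ f ≡ ∑∑ g
    ∑∑-cong f≗g = ∑-cong λ i → ∑-cong (f≗g i)

    ∑∑-+ : ∀ f g → ∑∑ (λ i j → f i j + g i j) ≡ ∑∑ f + ∑∑ g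
    ∑∑-+ f g = trans (∑-cong λ i → ∑-distrib-+ (f i) (g i)) (∑-distrib-+ (λ i → sum (f i)) (λ i → sum (g i)))

    ∑∑-swap : ∀ f → ∑∑ (λ i j → f j i) ≡ ∑∑ f
    ∑∑-swap f = ∑-comm (λ i j → f j i)

    ∑∑-row-involution : ∀ f → ∑∑ (λ i j → f i (i · j)) ≡ ∑∑ f
    ∑∑-row-involution f = ∑-cong λ i → ∑-involution (f i) (i ·_) (cancel i)

    toℕ-·-distinct : ∀ i j → toℕ i ≢ toℕ j → toℕ (i · j) ≢ toℕ i × toℕ (i · j) ≢ toℕ j
    toℕ-·-distinct i j toℕi≢toℕj = (·-≢ˡ i≢j ∘′ toℕ-injective) , (·-≢ʳ i≢j ∘′ toℕ-injective)
      where
      i≢j : i ≢ j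
      i≢j = toℕi≢toℕj ∘′ cong toℕ

    blocks : ℕ
    blocks = ∑∑ λ i j → ⟦asc⟧ (toℕ i) (toℕ j) (toℕ (i · j))

    blocks-middle : ∑∑ (λ i j → ⟦asc⟧ (toℕ i) (toℕ (i · j)) (toℕ j)) ≡ blocks
    blocks-middle = begin
      ∑∑ (λ i j → ⟦asc⟧ (toℕ i) (toℕ (i · j)) (toℕ j))
        ≡⟨ ∑∑-cong (λ i j → cong (⟦asc⟧ (toℕ i) (toℕ (i · j)) ∘′ toℕ) (sym (cancel i j))) ⟩
      ∑∑ (λ i j → F i (i · j))   ≡⟨ ∑∑-row-involution F ⟩
      blocks                     ∎
      where
      F : Fin (suc n) → Fin (suc n) → ℕ
      F i k = ⟦asc⟧ (toℕ i) (toℕ k) (toℕ (i · k))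

    blocks-first : ∑∑ (λ i j → ⟦asc⟧ (toℕ (i · j)) (toℕ i) (toℕ j)) ≡ blocks
    blocks-first = begin
      ∑∑ (λ i j → ⟦asc⟧ (toℕ (i · j)) (toℕ i) (toℕ j))
        ≡⟨ ∑∑-cong (λ i j → cong (⟦asc⟧ (toℕ (i · j)) (toℕ i) ∘′ toℕ)
                                 (sym (trans (comm (i · j) i) (cancel i j)))) ⟩
      ∑∑ (λ i j → G i (i · j))   ≡⟨ ∑∑-row-involution G ⟩
      ∑∑ G                       ≡⟨ ∑∑-swap (λ i j → ⟦asc⟧ (toℕ i) (toℕ j) (toℕ (i · j))) ⟩
      blocks                     ∎
      where
      G : Fin (suc n) → Fin (suc n) → ℕ
      G i k = ⟦asc⟧ (toℕ k) (toℕ i) (toℕ (k · i))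

    pairs≡3*blocks : ∑∑ (λ i j → ⟦pair⟧ (toℕ i) (toℕ j) (toℕ (i · j))) ≡ 3 * blocks
    pairs≡3*blocks = begin
      ∑∑ (λ i j → ⟦pair⟧ (toℕ i) (toℕ j) (toℕ (i · j)))
        ≡⟨ ∑∑-cong (λ i j → pair-split (toℕ-·-distinct i j)) ⟩
      ∑∑ (λ i j → ⟦asc⟧ (toℕ i) (toℕ j) (toℕ (i · j))
                + (⟦asc⟧ (toℕ i) (toℕ (i · j)) (toℕ j) + ⟦asc⟧ (toℕ (i · j)) (toℕ i) (toℕ j)))
        ≡⟨ ∑∑-+ (λ i j → ⟦asc⟧ (toℕ i) (toℕ j) (toℕ (i · j))) (λ i j → middle i j + first i j) ⟩
      blocks + ∑∑ (λ i j → ⟦asc⟧ (toℕ i) (toℕ (i · j)) (toℕ j) + ⟦asc⟧ (toℕ (i · j)) (toℕ i) (toℕ j))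
        ≡⟨ cong (blocks +_) (trans (∑∑-+ middle first) (cong₂ _+_ blocks-middle blocks-first)) ⟩
      blocks + (blocks + blocks)
        ≡⟨ cong (λ x → blocks + (blocks + x)) (sym (+-identityʳ blocks)) ⟩
      3 * blocks ∎
      where
      middle first : Fin (suc n) → Fin (suc n) → ℕ
      middle i j = ⟦asc⟧ (toℕ i) (toℕ (i · j)) (toℕ j)
      first  i j = ⟦asc⟧ (toℕ (i · j)) (toℕ i) (toℕ j)

    distinct≡6*blocks : ∑∑ (λ i j → ⟦distinct⟧ (toℕ i) (toℕ j) (toℕ (i · j))) ≡ 6 * blocks
    distinct≡6*blocks = begin
      ∑∑ (λ i j → ⟦distinct⟧ (toℕ i) (toℕ j) (toℕ (i · j)))
        ≡⟨ ∑∑-cong (λ i j → distinct-split (toℕ i) (toℕ j) (toℕ (i · j))) ⟩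
      ∑∑ (λ i j → ⟦pair⟧ (toℕ i) (toℕ j) (toℕ (i · j)) + ⟦pair⟧ (toℕ j) (toℕ i) (toℕ (i · j)))
        ≡⟨ ∑∑-+ (λ i j → ⟦pair⟧ (toℕ i) (toℕ j) (toℕ (i · j))) (λ i j → ⟦pair⟧ (toℕ j) (toℕ i) (toℕ (i · j))) ⟩
      pairs + ∑∑ (λ i j → ⟦pair⟧ (toℕ j) (toℕ i) (toℕ (i · j)))
        ≡⟨ cong (pairs +_) (trans (∑∑-cong (λ i j → cong (⟦pair⟧ (toℕ j) (toℕ i) ∘′ toℕ) (comm i j)))
                                    (∑∑-swap (λ i j → ⟦pair⟧ (toℕ i) (toℕ j) (toℕ (i · j))))) ⟩
      pairs + pairs
        ≡⟨ cong₂ _+_ pairs≡3*blocks pairs≡3*blocks ⟩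
      3 * blocks + 3 * blocks
        ≡⟨ sym (*-distribʳ-+ blocks 3 3) ⟩
      6 * blocks ∎
      where
      pairs : ℕ
      pairs = ∑∑ (λ i j → ⟦pair⟧ (toℕ i) (toℕ j) (toℕ (i · j)))

    last : Fin (suc n)
    last = fromℕ n

    <n⇒≢last : ∀ {k} → toℕ k < n → k ≢ last
    <n⇒≢last k<n k≡last = <-irrefl (trans (cong toℕ k≡last) (toℕ-fromℕ n)) k<n

    ≢last⇒<n : ∀ {k} → k ≢ last → toℕ k < n
    ≢last⇒<n {k} k≢last = ≤∧≢⇒< (s≤s⁻¹ (toℕ<n k)) (λ k≡n → k≢last (toℕ-injective (trans k≡n (sym (toℕ-fromℕ n)))))

    row-partition : ∀ {i} → toℕ i < n → ∀ j →
      ⟦distinct⟧ (toℕ i) (toℕ j) (toℕ (i · j))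
        + (iverson (j ≟ i) + (iverson (j ≟ last) + iverson (j ≟ i · last))) ≡ 1
    row-partition {i} i<n j = go (j ≟ i) (j ≟ last) (j ≟ i · last)
      where
      i≢last : i ≢ last
      i≢last = <n⇒≢last i<n
      D? : Dec (DistinctBelow (toℕ i) (toℕ j) (toℕ (i · j)))
      D? = DistinctBelow? (toℕ i) (toℕ j) (toℕ (i · j))
      go : (j≟i : Dec (j ≡ i)) (j≟last : Dec (j ≡ last)) (j≟i·last : Dec (j ≡ i · last)) →
           iverson D? + (iverson j≟i + (iverson j≟last + iverson j≟i·last)) ≡ 1
      go (yes refl) j≟last j≟i·last = cong₂ _+_ (iverson-no D? λ (j≢j , _) → j≢j refl)
        (cong suc (cong₂ _+_ (iverson-no j≟last i≢last) (iverson-no j≟i·last (·-≢ˡ i≢last ∘′ sym))))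
      go (no _) (yes refl) j≟i·last = cong₂ _+_ (iverson-no D? λ (_ , _ , j<n , _) → <n⇒≢last j<n refl)
        (cong suc (iverson-no j≟i·last (·-≢ʳ i≢last ∘′ sym)))
      go (no _) (no _) (yes refl) =
        cong (_+ 1) (iverson-no D? λ (_ , _ , _ , i·j<n) → <n⇒≢last i·j<n (cancel i last))
      go (no j≢i) (no j≢last) (no j≢i·last) = cong (_+ 0) (iverson-yes D?
        ( (j≢i ∘′ sym ∘′ toℕ-injective) , i<n , ≢last⇒<n j≢last
        , ≢last⇒<n (λ i·j≡last → j≢i·last (trans (sym (cancel i j)) (cong (i ·_) i·j≡last)))))

    row-count : ∀ {i} → toℕ i < n → ∑[ j < suc n ] ⟦distinct⟧ (toℕ i) (toℕ j) (toℕ (i · j)) ≡ n ∸ 2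
    row-count {i} i<n = begin
      ∑[ j < suc n ] D j                    ≡⟨ m+n∸n≡m _ 3 ⟨
      (∑[ j < suc n ] D j + 3) ∸ 3          ≡⟨ cong (_∸ 3) ∑D+3≡1+n ⟩
      suc n ∸ 3                             ∎
      where
      D : Fin (suc n) → ℕ
      D j = ⟦distinct⟧ (toℕ i) (toℕ j) (toℕ (i · j))
      is-i is-last is-i·last E : Fin (suc n) → ℕ
      is-i     j = iverson (j ≟ i)
      is-last  j = iverson (j ≟ last)
      is-i·last j = iverson (j ≟ i · last)
      E j = is-i j + (is-last j + is-i·last j)
      ∑D+3≡1+n : ∑[ j < suc n ] D j + 3 ≡ suc n
      ∑D+3≡1+n = begin
        ∑[ j < suc n ] D j + 3
          ≡⟨ cong (sum D +_) (cong₂ _+_ (∑-iverson-≡ i) (cong₂ _+_ (∑-iverson-≡ last) (∑-iverson-≡ (i · last)))) ⟨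
        ∑[ j < suc n ] D j + (∑[ j < suc n ] iverson (j ≟ i)
                           + (∑[ j < suc n ] iverson (j ≟ last) + ∑[ j < suc n ] iverson (j ≟ i · last)))
          ≡⟨ cong (sum D +_) (trans (∑-distrib-+ is-i (λ j → is-last j + is-i·last j))
                                    (cong (sum is-i +_) (∑-distrib-+ is-last is-i·last))) ⟨
        ∑[ j < suc n ] D j + ∑[ j < suc n ] E j ≡⟨ ∑-distrib-+ D E ⟨
        ∑[ j < suc n ] (D j + E j)               ≡⟨ ∑-cong (row-partition i<n) ⟩
        ∑[ j < suc n ] 1                         ≡⟨ ∑-const (suc n) 1 ⟩
        suc n * 1                                ≡⟨ *-identityʳ (suc n) ⟩
        suc n                                    ∎

    distinct≡n*[n∸2] : ∑∑ (λ i j → ⟦distinct⟧ (toℕ i) (toℕ j) (toℕ (i · j))) ≡ n * (n ∸ 2)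
    distinct≡n*[n∸2] = begin
      ∑[ i < suc n ] R i                       ≡⟨ sum-init-last R ⟩
      ∑[ i < n ] R (inject₁ i) + R last        ≡⟨ cong₂ _+_ (∑-cong λ i → row-count (inject₁<n i)) last-row ⟩
      ∑[ i < n ] (n ∸ 2) + 0                   ≡⟨ +-identityʳ _ ⟩
      ∑[ i < n ] (n ∸ 2)                       ≡⟨ ∑-const n (n ∸ 2) ⟩
      n * (n ∸ 2)                              ∎
      where
      R : Fin (suc n) → ℕ
      R i = ∑[ j < suc n ] ⟦distinct⟧ (toℕ i) (toℕ j) (toℕ (i · j))
      inject₁<n : (i : Fin n) → toℕ (inject₁ i) < n
      inject₁<n i = subst (_< n) (sym (toℕ-inject₁ i)) (toℕ<n i)
      last-row : R last ≡ 0
      last-row = trans (∑-cong λ j → iverson-no (DistinctBelow? (toℕ last) (toℕ j) (toℕ (last · j)))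
                                                λ (_ , last<n , _) → <n⇒≢last last<n refl)
                       (trans (∑-const (suc n) 0) (*-zeroʳ (suc n)))

    6*blocks≡n*[n∸2] : 6 * blocks ≡ n * (n ∸ 2)
    6*blocks≡n*[n∸2] = trans (sym distinct≡6*blocks) distinct≡n*[n∸2]

module SchönheimBound where
  open import Data.Bool using (true; false; T)
  open import Data.Nat using (ℕ; zero; suc; _+_; _*_; _∸_; _/_; _%_; _≡ᵇ_; z≤n; s≤s)
  open import Data.Nat.Properties using (≡ᵇ⇒≡; even≢odd; *-comm; *-cancelʳ-≡; *-cancelˡ-≡)
  open import Data.Product using (∃; _,_)
  open import Data.Sum using (_⊎_; inj₁; inj₂)
  open import Data.Nat.DivMod using (m≡m%n+[m/n]*n; m*n/n≡m; m/n≡1+[m∸n]/n)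
  open import Data.Nat.Tactic.RingSolver using (solve-∀)
  open import Data.Unit using (tt)
  open import Relation.Binary.PropositionalEquality
  open ≡-Reasoning
  open import Relation.Nullary using (contradiction)

  [1+k*2]/2≡k : ∀ k → suc (k * 2) / 2 ≡ k
  [1+k*2]/2≡k zero    = refl
  [1+k*2]/2≡k (suc k) = trans (m/n≡1+[m∸n]/n {3 + k * 2} (s≤s (s≤s z≤n))) (cong suc ([1+k*2]/2≡k k))

  ε-even : ∀ k → ε (k * 2) ≡ 0
  ε-even k with (k * 2) % 6 ≡ᵇ 5 in r≡ᵇ5
  ... | false = refl
  ... | true  = contradiction (begin
    2 * k                     ≡⟨ *-comm 2 k ⟩
    k * 2                     ≡⟨ m≡m%n+[m/n]*n (k * 2) 6 ⟩
    (k * 2) % 6 + q * 6       ≡⟨ cong (_+ q * 6) (≡ᵇ⇒≡ _ 5 (subst T (sym r≡ᵇ5) tt)) ⟩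
    5 + q * 6                 ≡⟨ 5+q*6-odd q ⟩
    suc (2 * (2 + q * 3))     ∎) (even≢odd k (2 + q * 3))
    where
    q : ℕ
    q = (k * 2) / 6
    5+q*6-odd : ∀ q → 5 + q * 6 ≡ suc (2 * (2 + q * 3))
    5+q*6-odd = solve-∀

  U3-even : ∀ m X → 6 * X ≡ (2 + m * 2) * (m * 2) → X ≡ U3 (2 + m * 2)
  U3-even m X 6X≡ = sym (begin
    U3 (2 + m * 2)
      ≡⟨ cong₂ _∸_ (cong (λ h → h * (2 + m * 2) / 3) ([1+k*2]/2≡k m)) (ε-even (suc m)) ⟩
    m * (2 + m * 2) / 3                    ≡⟨ cong (_/ 3) (sym X*3≡) ⟩
    X * 3 / 3                              ≡⟨ m*n/n≡m X 3 ⟩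
    X                                      ∎)
    where
    X*3≡ : X * 3 ≡ m * (2 + m * 2)
    X*3≡ = *-cancelʳ-≡ (X * 3) (m * (2 + m * 2)) 2 (begin
      X * 3 * 2                ≡⟨ X*3*2≡6*X X ⟩
      6 * X                    ≡⟨ 6X≡ ⟩
      (2 + m * 2) * (m * 2)    ≡⟨ reassociate m ⟩
      m * (2 + m * 2) * 2      ∎)
      where
      X*3*2≡6*X : ∀ X → X * 3 * 2 ≡ 6 * X
      X*3*2≡6*X = solve-∀
      reassociate : ∀ m → (2 + m * 2) * (m * 2) ≡ m * (2 + m * 2) * 2
      reassociate = solve-∀

  6*X≢odd*odd : ∀ m X → 6 * X ≢ (3 + m * 2) * (1 + m * 2)
  6*X≢odd*odd m X 6X≡ = even≢odd (3 * X) (1 + m * 4 + m * m * 2) (begin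
    2 * (3 * X)                        ≡⟨ 2*[3*X]≡6*X X ⟩
    6 * X                              ≡⟨ 6X≡ ⟩
    (3 + m * 2) * (1 + m * 2)          ≡⟨ expand m ⟩
    suc (2 * (1 + m * 4 + m * m * 2))  ∎)
    where
    2*[3*X]≡6*X : ∀ X → 2 * (3 * X) ≡ 6 * X
    2*[3*X]≡6*X = solve-∀
    expand : ∀ m → (3 + m * 2) * (1 + m * 2) ≡ suc (2 * (1 + m * 4 + m * m * 2))
    expand = solve-∀

  parity : ∀ n → ∃ λ k → n ≡ k * 2 ⊎ n ≡ suc (k * 2)
  parity zero = 0 , inj₁ refl
  parity (suc n) with parity n
  ... | k , inj₁ n≡2k   = k , inj₂ (cong suc n≡2k)
  ... | k , inj₂ n≡2k+1 = suc k , inj₁ (cong suc n≡2k+1)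

  6*X≡n*[n∸2]⇒X≡U3 : ∀ n X → 6 * X ≡ n * (n ∸ 2) → X ≡ U3 n
  6*X≡n*[n∸2]⇒X≡U3 n X 6X≡ with parity n
  ... | zero  , inj₁ refl = *-cancelˡ-≡ X 0 6 6X≡
  ... | suc m , inj₁ refl = U3-even m X 6X≡
  ... | zero  , inj₂ refl = *-cancelˡ-≡ X 0 6 6X≡
  ... | suc m , inj₂ refl = contradiction 6X≡ (6*X≢odd*odd m X)

module PlaneGeometry {c ℓ : Level} (F : Field c ℓ) where
  open import Data.Product using (_×_; _,_; proj₁)
  open import Data.Sum using (_⊎_; inj₁; inj₂)
  open import Relation.Nullary using (¬_; yes; no)
  open import Relation.Nullary.Decidable using (¬¬-excluded-middle)
  open Field F
  open Projective F
  open import Relation.Binary.Reasoning.Setoid setoid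
  open import Algebra.Solver.Ring.NaturalCoefficients.Default commutativeSemiring
    using (solve; _:=_; _:+_; _:*_)
  open import Algebra.Properties.Ring ring using (x[y-z]≈xy-xz)
  open import Algebra.Properties.Group +-group using (x∙y⁻¹≈ε⇒x≈y; x≈y⇒x∙y⁻¹≈ε)
  open import Algebra.Properties.AbelianGroup +-abelianGroup using (⁻¹-∙-comm)

  dot : Vec3 → Vec3 → Carrier
  dot (a , b , c) (x , y , z) = a * x + b * y + c * z

  _⊖_ : Vec3 → Vec3 → Vec3
  (a , b , c) ⊖ (x , y , z) = a - x , b - y , c - z

  -- cross L M = cross⁺ L M ⊖ cross⁻ L M, so that identities about cross products
  -- reduce to identities in the commutative semiring, where they are solvable.
  cross⁺ cross⁻ cross : Vec3 → Vec3 → Vec3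
  cross⁺ (a , b , c) (d , e , f) = b * f , c * d , a * e
  cross⁻ (a , b , c) (d , e , f) = c * e , a * f , b * d
  cross L M = cross⁺ L M ⊖ cross⁻ L M

  IsZero : Vec3 → Set ℓ
  IsZero (x , y , z) = (x ≈ 0#) × (y ≈ 0#) × (z ≈ 0#)

  rotate : Vec3 → Vec3
  rotate (x , y , z) = y , z , x

  dot-⊖ : ∀ L u v → dot L (u ⊖ v) ≈ dot L u - dot L v
  dot-⊖ (a , b , c) (u₁ , u₂ , u₃) (v₁ , v₂ , v₃) = begin
    a * (u₁ - v₁) + b * (u₂ - v₂) + c * (u₃ - v₃)
      ≈⟨ +-cong (+-cong (x[y-z]≈xy-xz a u₁ v₁) (x[y-z]≈xy-xz b u₂ v₂)) (x[y-z]≈xy-xz c u₃ v₃) ⟩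
    (a * u₁ - a * v₁) + (b * u₂ - b * v₂) + (c * u₃ - c * v₃)
      ≈⟨ solve 6 (λ x₁ y₁ x₂ y₂ x₃ y₃ → (x₁ :+ y₁) :+ (x₂ :+ y₂) :+ (x₃ :+ y₃)
                                       := (x₁ :+ x₂ :+ x₃) :+ (y₁ :+ y₂ :+ y₃))
                 refl (a * u₁) (- (a * v₁)) (b * u₂) (- (b * v₂)) (c * u₃) (- (c * v₃)) ⟩
    (a * u₁ + b * u₂ + c * u₃) + (- (a * v₁) + - (b * v₂) + - (c * v₃))
      ≈⟨ +-cong refl (trans (+-cong (⁻¹-∙-comm _ _) refl) (⁻¹-∙-comm _ _)) ⟩
    (a * u₁ + b * u₂ + c * u₃) - (a * v₁ + b * v₂ + c * v₃) ∎

  dot-cross-zeroˡ : ∀ L M → dot L (cross L M) ≈ 0#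
  dot-cross-zeroˡ L@(a , b , c) M@(d , e , f) = trans (dot-⊖ L (cross⁺ L M) (cross⁻ L M)) (x≈y⇒x∙y⁻¹≈ε
    (solve 6 (λ a b c d e f → a :* (b :* f) :+ b :* (c :* d) :+ c :* (a :* e)
                            := a :* (c :* e) :+ b :* (a :* f) :+ c :* (b :* d)) refl a b c d e f))

  dot-cross-zeroʳ : ∀ L M → dot M (cross L M) ≈ 0#
  dot-cross-zeroʳ L@(a , b , c) M@(d , e , f) = trans (dot-⊖ M (cross⁺ L M) (cross⁻ L M)) (x≈y⇒x∙y⁻¹≈ε
    (solve 6 (λ a b c d e f → d :* (b :* f) :+ e :* (c :* d) :+ f :* (a :* e)
                            := d :* (c :* e) :+ e :* (a :* f) :+ f :* (b :* d)) refl a b c d e f))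

  dot-rotate : ∀ u v → dot (rotate u) (rotate v) ≈ dot u v
  dot-rotate (a , b , c) (x , y , z) =
    solve 6 (λ a b c x y z → b :* y :+ c :* z :+ a :* x := a :* x :+ b :* y :+ c :* z) refl a b c x y z

  Rescales : Carrier → Carrier → Vec3 → Vec3 → Set ℓ
  Rescales d t (x₁ , x₂ , x₃) (y₁ , y₂ , y₃) = (d * y₁ ≈ t * x₁) × (d * y₂ ≈ t * x₂) × (d * y₃ ≈ t * x₃)

  rescales⇒proportional : ∀ {d t} x y → ¬ (d ≈ 0#) → NonzeroVec y → Rescales d t x y → Proportional x y
  rescales⇒proportional {d} {t} (x₁ , x₂ , x₃) (y₁ , y₂ , y₃) d≉0 y≉0 (e₁ , e₂ , e₃)
    with inverse d d≉0
  ... | d⁻¹ , dd⁻¹≈1 = k , k≉0 , divide e₁ , divide e₂ , divide e₃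
    where
    k : Carrier
    k = d⁻¹ * t
    divide : ∀ {xᵢ yᵢ} → d * yᵢ ≈ t * xᵢ → yᵢ ≈ k * xᵢ
    divide {xᵢ} {yᵢ} eᵢ = begin
      yᵢ               ≈⟨ *-identityˡ yᵢ ⟨
      1# * yᵢ          ≈⟨ *-cong dd⁻¹≈1 refl ⟨
      d * d⁻¹ * yᵢ     ≈⟨ solve 3 (λ d d⁻¹ y → d :* d⁻¹ :* y := d⁻¹ :* (d :* y)) refl d d⁻¹ yᵢ ⟩
      d⁻¹ * (d * yᵢ)   ≈⟨ *-cong refl eᵢ ⟩
      d⁻¹ * (t * xᵢ)   ≈⟨ *-assoc d⁻¹ t xᵢ ⟨
      k * xᵢ           ∎
    vanishes : ∀ {xᵢ yᵢ} → d * yᵢ ≈ t * xᵢ → k ≈ 0# → yᵢ ≈ 0#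
    vanishes {xᵢ} eᵢ k≈0 = trans (divide eᵢ) (trans (*-cong k≈0 refl) (zeroˡ xᵢ))
    k≉0 : ¬ (k ≈ 0#)
    k≉0 k≈0 = y≉0 (vanishes e₁ k≈0 , vanishes e₂ k≈0 , vanishes e₃ k≈0)

  proportional-unrotate : ∀ x y → Proportional (rotate x) (rotate y) → Proportional x y
  proportional-unrotate _ _ (k , k≉0 , e₂ , e₃ , e₁) = k , k≉0 , e₁ , e₂ , e₃

  proportional-sym : ∀ x y → NonzeroVec x → Proportional x y → Proportional y x
  proportional-sym x@(x₁ , x₂ , x₃) y@(y₁ , y₂ , y₃) x≉0 (k , k≉0 , e₁ , e₂ , e₃) =
    rescales⇒proportional y x k≉0 x≉0 (flip e₁ , flip e₂ , flip e₃)
    where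
    flip : ∀ {xᵢ yᵢ} → yᵢ ≈ k * xᵢ → k * xᵢ ≈ 1# * yᵢ
    flip {yᵢ = yᵢ} e = trans (sym e) (sym (*-identityˡ yᵢ))

  dot-proportional : ∀ L {v w} → Proportional v w → dot L v ≈ 0# → dot L w ≈ 0#
  dot-proportional (a , b , c) {x , y , z} {x′ , y′ , z′} (k , _ , ex , ey , ez) Lv≈0 = begin
    a * x′ + b * y′ + c * z′                ≈⟨ +-cong (+-cong (*-cong refl ex) (*-cong refl ey)) (*-cong refl ez) ⟩
    a * (k * x) + b * (k * y) + c * (k * z) ≈⟨ solve 7 (λ a b c k x y z →
                                                 a :* (k :* x) :+ b :* (k :* y) :+ c :* (k :* z)
                                                 := k :* (a :* x :+ b :* y :+ c :* z)) refl a b c k x y z ⟩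
    k * (a * x + b * y + c * z)             ≈⟨ *-cong refl Lv≈0 ⟩
    k * 0#                                  ≈⟨ zeroʳ k ⟩
    0#                                      ∎

  cross-zero⇒proportional : ∀ {a b c} M → ¬ (a ≈ 0#) → NonzeroVec M → IsZero (cross (a , b , c) M) →
                            Proportional (a , b , c) M
  cross-zero⇒proportional {a} {b} {c} M@(d , e , f) a≉0 M≉0 (_ , cd-af≈0 , ae-bd≈0) =
    rescales⇒proportional (a , b , c) M a≉0 M≉0
      ( *-comm a d
      , trans (x∙y⁻¹≈ε⇒x≈y _ _ ae-bd≈0) (*-comm b d)
      , trans (sym (x∙y⁻¹≈ε⇒x≈y _ _ cd-af≈0)) (*-comm c d))

  some-coordinate-nonzero : ∀ {x y z} → NonzeroVec (x , y , z) → ¬ ¬ (¬ x ≈ 0# ⊎ ¬ y ≈ 0# ⊎ ¬ z ≈ 0#)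
  some-coordinate-nonzero {x} {y} {z} v≉0 none =
    ¬¬-excluded-middle {A = x ≈ 0#} λ
      { (no x≉0)  → none (inj₁ x≉0)
      ; (yes x≈0) → ¬¬-excluded-middle {A = y ≈ 0#} λ
        { (no y≉0)  → none (inj₂ (inj₁ y≉0))
        ; (yes y≈0) → ¬¬-excluded-middle {A = z ≈ 0#} λ
          { (no z≉0)  → none (inj₂ (inj₂ z≉0))
          ; (yes z≈0) → v≉0 (x≈0 , y≈0 , z≈0) } } }

  cross-nonzero : ∀ L M → NonzeroVec L → NonzeroVec M → ¬ Proportional L M → NonzeroVec (cross L M)
  cross-nonzero L@(a , b , c) M@(d , e , f) L≉0 M≉0 L≁M (z₁ , z₂ , z₃) = some-coordinate-nonzero L≉0 λ
    { (inj₁ a≉0)        → L≁M (cross-zero⇒proportional M a≉0 M≉0 (z₁ , z₂ , z₃))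
    ; (inj₂ (inj₁ b≉0)) → L≁M (proportional-unrotate L M
                            (cross-zero⇒proportional (e , f , d) b≉0 M′≉0 (z₂ , z₃ , z₁)))
    ; (inj₂ (inj₂ c≉0)) → L≁M (proportional-unrotate L M (proportional-unrotate (b , c , a) (e , f , d)
                            (cross-zero⇒proportional (f , d , e) c≉0 M″≉0 (z₃ , z₁ , z₂)))) }
    where
    M′≉0 : NonzeroVec (e , f , d)
    M′≉0 (e≈0 , f≈0 , d≈0) = M≉0 (d≈0 , e≈0 , f≈0)
    M″≉0 : NonzeroVec (f , d , e)
    M″≉0 (f≈0 , d≈0 , e≈0) = M≉0 (d≈0 , e≈0 , f≈0)

  drop-vanishing : ∀ {α β A B X Y X′ Y′} → α ≈ 0# → β ≈ 0# →
                   A + (α * X + β * Y) ≈ B + (α * X′ + β * Y′) → A ≈ B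
  drop-vanishing {α} {β} {A} {B} {X} {Y} {X′} {Y′} α≈0 β≈0 eq = begin
    A                            ≈⟨ +-identityʳ A ⟨
    A + 0#                       ≈⟨ +-cong refl (vanish X Y) ⟨
    A + (α * X + β * Y)          ≈⟨ eq ⟩
    B + (α * X′ + β * Y′)        ≈⟨ +-cong refl (vanish X′ Y′) ⟩
    B + 0#                       ≈⟨ +-identityʳ B ⟩
    B                            ∎
    where
    vanish : ∀ Z W → α * Z + β * W ≈ 0#
    vanish Z W = trans (+-cong (trans (*-cong α≈0 refl) (zeroˡ Z)) (trans (*-cong β≈0 refl) (zeroˡ W)))
                       (+-identityʳ 0#)

  exchange-differences : ∀ {A B C D} → A + D ≈ C + B → A - B ≈ C - D
  exchange-differences {A} {B} {C} {D} eq = begin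
    A - B                    ≈⟨ +-identityʳ (A - B) ⟨
    (A - B) + 0#             ≈⟨ +-cong refl (-‿inverseʳ D) ⟨
    (A - B) + (D - D)
      ≈⟨ solve 4 (λ A B D D′ → (A :+ B) :+ (D :+ D′) := (A :+ D) :+ (B :+ D′)) refl A (- B) D (- D) ⟩
    (A + D) + (- B - D)      ≈⟨ +-cong eq refl ⟩
    (C + B) + (- B - D)
      ≈⟨ solve 4 (λ C B B′ D′ → (C :+ B) :+ (B′ :+ D′) := C :+ (B :+ B′) :+ D′) refl C B (- B) (- D) ⟩
    C + (B - B) - D          ≈⟨ +-cong (+-cong refl (-‿inverseʳ B)) refl ⟩
    C + 0# - D               ≈⟨ +-cong (+-identityʳ C) refl ⟩
    C - D                    ∎

  -- First coordinate of the expansion (N·(L×M)) q = (N·q) (L×M) + (L·q) (M×N) + (M·q) (N×L).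
  meet-rescales₁ : ∀ L M N q → dot L q ≈ 0# → dot M q ≈ 0# →
                   dot N (cross L M) * proj₁ q ≈ dot N q * proj₁ (cross L M)
  meet-rescales₁ L@(l₁ , l₂ , l₃) M@(m₁ , m₂ , m₃) N@(n₁ , n₂ , n₃) q@(q₁ , q₂ , q₃) Lq≈0 Mq≈0 = begin
    dot N (cross L M) * q₁   ≈⟨ *-cong (dot-⊖ N (cross⁺ L M) (cross⁻ L M)) refl ⟩
    (U - W) * q₁             ≈⟨ *-comm (U - W) q₁ ⟩
    q₁ * (U - W)             ≈⟨ x[y-z]≈xy-xz q₁ U W ⟩
    q₁ * U - q₁ * W
      ≈⟨ exchange-differences (drop-vanishing Lq≈0 Mq≈0 (expansion l₁ l₂ l₃ m₁ m₂ m₃ n₁ n₂ n₃ q₁ q₂ q₃)) ⟩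
    t * (l₂ * m₃) - t * (l₃ * m₂) ≈⟨ x[y-z]≈xy-xz t _ _ ⟨
    t * proj₁ (cross L M)    ∎
    where
    U W t : Carrier
    U = dot N (cross⁺ L M)
    W = dot N (cross⁻ L M)
    t = dot N q
    expansion : ∀ l₁ l₂ l₃ m₁ m₂ m₃ n₁ n₂ n₃ q₁ q₂ q₃ →
      let U = n₁ * (l₂ * m₃) + n₂ * (l₃ * m₁) + n₃ * (l₁ * m₂)
          W = n₁ * (l₃ * m₂) + n₂ * (l₁ * m₃) + n₃ * (l₂ * m₁)
          t = n₁ * q₁ + n₂ * q₂ + n₃ * q₃
          α = l₁ * q₁ + l₂ * q₂ + l₃ * q₃
          β = m₁ * q₁ + m₂ * q₂ + m₃ * q₃
      in q₁ * U + t * (l₃ * m₂) + (α * (m₃ * n₂) + β * (n₃ * l₂))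
         ≈ t * (l₂ * m₃) + q₁ * W + (α * (m₂ * n₃) + β * (n₂ * l₃))
    expansion = solve 12 (λ l₁ l₂ l₃ m₁ m₂ m₃ n₁ n₂ n₃ q₁ q₂ q₃ →
      let U = n₁ :* (l₂ :* m₃) :+ n₂ :* (l₃ :* m₁) :+ n₃ :* (l₁ :* m₂)
          W = n₁ :* (l₃ :* m₂) :+ n₂ :* (l₁ :* m₃) :+ n₃ :* (l₂ :* m₁)
          t = n₁ :* q₁ :+ n₂ :* q₂ :+ n₃ :* q₃
          α = l₁ :* q₁ :+ l₂ :* q₂ :+ l₃ :* q₃
          β = m₁ :* q₁ :+ m₂ :* q₂ :+ m₃ :* q₃
      in q₁ :* U :+ t :* (l₃ :* m₂) :+ (α :* (m₃ :* n₂) :+ β :* (n₃ :* l₂))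
         := t :* (l₂ :* m₃) :+ q₁ :* W :+ (α :* (m₂ :* n₃) :+ β :* (n₂ :* l₃))) refl

  meet-rescales : ∀ L M N q → dot L q ≈ 0# → dot M q ≈ 0# → Rescales (dot N (cross L M)) (dot N q) (cross L M) q
  meet-rescales L M N q Lq≈0 Mq≈0 =
      meet-rescales₁ L M N q Lq≈0 Mq≈0
    , unrotate N (meet-rescales₁ (rotate L) (rotate M) (rotate N) (rotate q)
                   (on-rotated L Lq≈0) (on-rotated M Mq≈0))
    , unrotate N (unrotate (rotate N) (meet-rescales₁ (rotate (rotate L)) (rotate (rotate M)) (rotate (rotate N))
                   (rotate (rotate q)) (on-rotated (rotate L) (on-rotated L Lq≈0))
                   (on-rotated (rotate M) (on-rotated M Mq≈0))))
    where
    on-rotated : ∀ K {v} → dot K v ≈ 0# → dot (rotate K) (rotate v) ≈ 0#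
    on-rotated K {v} Kv≈0 = trans (dot-rotate K v) Kv≈0
    unrotate : ∀ K {u v x y} → dot (rotate K) (rotate u) * x ≈ dot (rotate K) (rotate v) * y →
               dot K u * x ≈ dot K v * y
    unrotate K {u} {v} eq = trans (*-cong (sym (dot-rotate K u)) refl) (trans eq (*-cong (dot-rotate K v) refl))

  -- The line N missing L×M supplies the scaling factor (N·q)/(N·(L×M)), which could not be
  -- constructed from the mere nonvanishing of q.
  on-both⇒proportional-cross : ∀ L M N q → dot L q ≈ 0# → dot M q ≈ 0# → ¬ (dot N (cross L M) ≈ 0#) →
                               NonzeroVec q → Proportional (cross L M) q
  on-both⇒proportional-cross L M N q Lq≈0 Mq≈0 N∌L×M q≉0 =
    rescales⇒proportional (cross L M) q N∌L×M q≉0 (meet-rescales L M N q Lq≈0 Mq≈0)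

open import Data.Nat using (ℕ; suc; _<_; _≤_; _∸_; _≤?_; z≤n; s≤s)
open import Data.Nat.Properties using (<⇒≢; >⇒≢; <-trans; ≤-<-trans; <⇒≱; ≰⇒>)
open import Data.Fin using (Fin; toℕ; inject₁; lower₁)
open import Data.Fin.Properties
  using (_≟_; inject₁-injective; inject₁-lower₁; toℕ-lower₁; toℕ-inject₁; toℕ-injective; toℕ<n)
open import Data.Product using (Σ; ∃; _×_; _,_; proj₁; proj₂)
open import Data.Sum using (inj₁; inj₂)
open import Function using (_∘′_)
open import Relation.Binary.PropositionalEquality
open import Relation.Nullary using (¬_; Dec; yes; no; contradiction)
open SteinerQuasigroups
open Counting
open Triples
open SchönheimBound

module Meets {c ℓ : Level} {F : Field c ℓ} {s : ℕ} (A : Arrangement F s) where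
  open Field F using (_≈_; 0#)
  open Projective F
  open Arrangement A
  open PlaneGeometry F

  coords : Fin s → Vec3
  coords i = proj₁ (line i)

  meet : ∀ {i j} → i ≢ j → Point
  meet {i} {j} i≢j = cross (coords i) (coords j)
                   , cross-nonzero (coords i) (coords j) (proj₂ (line i)) (proj₂ (line j)) (distinct i j i≢j)

  -- Stated through coordinates so that it does not depend on the proof of i ≢ j.
  OnMeet : Fin s → Fin s → Fin s → Set ℓ
  OnMeet i j m = dot (coords m) (cross (coords i) (coords j)) ≈ 0#

  on-meetˡ : ∀ i j → OnMeet i j i
  on-meetˡ i j = dot-cross-zeroˡ (coords i) (coords j)

  on-meetʳ : ∀ i j → OnMeet i j j
  on-meetʳ i j = dot-cross-zeroʳ (coords i) (coords j)

  record IsThirdLine (i j t : Fin s) : Set ℓ where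
    field
      t≢i     : t ≢ i
      t≢j     : t ≢ j
      on-meet : OnMeet i j t
      only    : ∀ m → OnMeet i j m → m ∈₃ (i , j , t)

  third-line-of-triple-point : ∀ {i j} (i≢j : i ≢ j) → TriplePoint A (meet i≢j) → Σ (Fin s) (IsThirdLine i j)
  third-line-of-triple-point {i} {j} i≢j (x , y , z , x<y , y<z , on-x , on-y , on-z , only-xyz) =
    third (third-of-three (<⇒≢ x<y ∘′ cong toℕ) (<⇒≢ y<z ∘′ cong toℕ) (<⇒≢ (<-trans x<y y<z) ∘′ cong toℕ)
                     (only-xyz i (on-meetˡ i j)) (only-xyz j (on-meetʳ i j)) i≢j)
    where
    on-xyz : ∀ {m} → m ∈₃ (x , y , z) → OnMeet i j m
    on-xyz (inj₁ refl)        = on-x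
    on-xyz (inj₂ (inj₁ refl)) = on-y
    on-xyz (inj₂ (inj₂ refl)) = on-z
    third : (Σ (Fin s) λ t → t ∈₃ (x , y , z) × t ≢ i × t ≢ j × (∀ w → w ∈₃ (x , y , z) → w ∈₃ (i , j , t))) →
            Σ (Fin s) (IsThirdLine i j)
    third (t , t∈xyz , t≢i , t≢j , xyz⊆ijt) = t , record
      { t≢i = t≢i ; t≢j = t≢j ; on-meet = on-xyz t∈xyz ; only = λ m on-m → xyz⊆ijt m (only-xyz m on-m) }

module ThirdLine {c ℓ : Level} {F : Field c ℓ} {s : ℕ} (A : Arrangement F s)
                 (all-triple : AllIntersectionsTriple A) (3<s : 3 < s) where
  open Projective F
  open Arrangement A
  open PlaneGeometry F
  open Meets A

  third-line : ∀ {i j} → i ≢ j → Σ (Fin s) (IsThirdLine i j)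
  third-line {i} {j} i≢j =
    third-line-of-triple-point i≢j (all-triple (meet i≢j) (i , j , i≢j , on-meetˡ i j , on-meetʳ i j))

  _·_ : Fin s → Fin s → Fin s
  i · j with i ≟ j
  ... | yes _  = i
  ... | no i≢j = proj₁ (third-line i≢j)

  ·-idem : ∀ i → i · i ≡ i
  ·-idem i with i ≟ i
  ... | yes _  = refl
  ... | no i≢i = contradiction refl i≢i

  ·-third : ∀ {i j} → i ≢ j → IsThirdLine i j (i · j)
  ·-third {i} {j} i≢j with i ≟ j
  ... | yes i≡j = contradiction i≡j i≢j
  ... | no i≢j′ = proj₂ (third-line i≢j′)

  line-missing-meet : ∀ {i j} → i ≢ j → ∃ λ w → ¬ OnMeet i j w
  line-missing-meet {i} {j} i≢j =
    let w , w∉ = outside-three 3<s i j (i · j) in w , w∉ ∘′ IsThirdLine.only (·-third i≢j) w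

  meet-unique : ∀ {i j} (i≢j : i ≢ j) (p : Point) → p ∈ᴸ line i → p ∈ᴸ line j → SamePoint (meet i≢j) p
  meet-unique {i} {j} i≢j (q , q≉0) q∈i q∈j =
    let w , w∌meet = line-missing-meet i≢j
    in on-both⇒proportional-cross (coords i) (coords j) (coords w) q q∈i q∈j w∌meet q≉0

  on-same-point : ∀ {i j m} (i≢j : i ≢ j) (p : Point) → SamePoint (meet i≢j) p → p ∈ᴸ line m → OnMeet i j m
  on-same-point {i} {j} {m} i≢j (q , _) meet~p q∈m =
    dot-proportional (coords m) (proportional-sym (proj₁ (meet i≢j)) q (proj₂ (meet i≢j)) meet~p) q∈m

  ·-comm-≢ : ∀ {i j} → i ≢ j → i · j ≡ j · i
  ·-comm-≢ {i} {j} i≢j = sym (∈₃-third (IsThirdLine.only (·-third i≢j) (j · i) on-meet-ij) ji.t≢j ji.t≢i)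
    where
    j≢i : j ≢ i
    j≢i = i≢j ∘′ sym
    module ji = IsThirdLine (·-third j≢i)
    on-meet-ij : OnMeet i j (j · i)
    on-meet-ij = on-same-point i≢j (meet j≢i) (meet-unique i≢j (meet j≢i) (on-meetʳ j i) (on-meetˡ j i)) ji.on-meet

  ·-comm : ∀ i j → i · j ≡ j · i
  ·-comm i j = by-cases (i ≟ j)
    where
    by-cases : Dec (i ≡ j) → i · j ≡ j · i
    by-cases (yes refl) = refl
    by-cases (no i≢j) = ·-comm-≢ i≢j

  ·-cancel-≢ : ∀ {i j} → i ≢ j → i · (i · j) ≡ j
  ·-cancel-≢ {i} {j} i≢j =
    sym (∈₃-third (IsThirdLine.only (·-third i≢t) j on-meet-it) (i≢j ∘′ sym) (ij.t≢j ∘′ sym))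
    where
    module ij = IsThirdLine (·-third i≢j)
    i≢t : i ≢ i · j
    i≢t = ij.t≢i ∘′ sym
    on-meet-it : OnMeet i (i · j) j
    on-meet-it = on-same-point i≢t (meet i≢j) (meet-unique i≢t (meet i≢j) (on-meetˡ i j) ij.on-meet)
                               (on-meetʳ i j)

  ·-cancel : ∀ i j → i · (i · j) ≡ j
  ·-cancel i j = by-cases (i ≟ j)
    where
    by-cases : Dec (i ≡ j) → i · (i · j) ≡ j
    by-cases (yes refl) = trans (cong (i ·_) (·-idem i)) (·-idem i)
    by-cases (no i≢j)   = ·-cancel-≢ i≢j

  ·-isSteinerQuasigroup : IsSteinerQuasigroup _·_
  ·-isSteinerQuasigroup = record { idem = ·-idem ; comm = ·-comm ; cancel = ·-cancel }

lower : ∀ {n} (k : Fin (suc n)) → toℕ k < n → Fin n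
lower k k<n = lower₁ k (>⇒≢ k<n)

inject₁-lower : ∀ {n} (k : Fin (suc n)) (k<n : toℕ k < n) → inject₁ (lower k k<n) ≡ k
inject₁-lower k k<n = inject₁-lower₁ k (>⇒≢ k<n)

toℕ-lower : ∀ {n} (k : Fin (suc n)) (k<n : toℕ k < n) → toℕ (lower k k<n) ≡ toℕ k
toℕ-lower k k<n = toℕ-lower₁ k (>⇒≢ k<n)

deleteLast : ∀ {c ℓ} {F : Field c ℓ} {n} → Arrangement F (suc n) → Arrangement F n
deleteLast A = record
  { line     = line ∘′ inject₁
  ; distinct = λ a b a≢b → distinct (inject₁ a) (inject₁ b) (a≢b ∘′ inject₁-injective) }
  where open Arrangement A

module Deletion {c ℓ : Level} {F : Field c ℓ} {n : ℕ} (A : Arrangement F (suc n))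
                (all-triple : AllIntersectionsTriple A) (3<1+n : 3 < suc n) where
  open Projective F
  open PlaneGeometry F
  open Meets A
  open ThirdLine A all-triple 3<1+n
  open BlocksAvoidingLast n ·-isSteinerQuasigroup

  Block : Fin (suc n) → Fin (suc n) → Set
  Block i j = Ascending (toℕ i) (toℕ j) (toℕ (i · j))

  block⇒≢ : ∀ {i j} → Block i j → i ≢ j
  block⇒≢ (i<j , _) = <⇒≢ i<j ∘′ cong toℕ

  block-meet-triple : ∀ {i j} (b : Block i j) → TriplePoint (deleteLast A) (meet (block⇒≢ b))
  block-meet-triple {i} {j} b@(i<j , j<t , t<n) =
      lower i i<n , lower j j<n , lower t t<n
    , subst₂ _<_ (sym (toℕ-lower i i<n)) (sym (toℕ-lower j j<n)) i<j
    , subst₂ _<_ (sym (toℕ-lower j j<n)) (sym (toℕ-lower t t<n)) j<t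
    , subst (OnMeet i j) (sym (inject₁-lower i i<n)) (on-meetˡ i j)
    , subst (OnMeet i j) (sym (inject₁-lower j j<n)) (on-meetʳ i j)
    , subst (OnMeet i j) (sym (inject₁-lower t t<n)) ij.on-meet
    , λ m on-m → lowered (ij.only (inject₁ m) on-m)
    where
    module ij = IsThirdLine (·-third (block⇒≢ b))
    t : Fin (suc n)
    t = i · j
    j<n : toℕ j < n
    j<n = <-trans j<t t<n
    i<n : toℕ i < n
    i<n = <-trans i<j j<n
    lowered : ∀ {m} → inject₁ m ∈₃ (i , j , t) → m ∈₃ (lower i i<n , lower j j<n , lower t t<n)
    lowered (inj₁ m≡i)        = inj₁ (inject₁-injective (trans m≡i (sym (inject₁-lower i i<n))))
    lowered (inj₂ (inj₁ m≡j)) = inj₂ (inj₁ (inject₁-injective (trans m≡j (sym (inject₁-lower j j<n)))))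
    lowered (inj₂ (inj₂ m≡t)) = inj₂ (inj₂ (inject₁-injective (trans m≡t (sym (inject₁-lower t t<n)))))

  triple-point⇒block : ∀ p → TriplePoint (deleteLast A) p →
                       ∃ λ i → ∃ λ j → Σ (Block i j) λ b → SamePoint p (meet (block⇒≢ b))
  triple-point⇒block p@(q , q≉0) (a , b , c , a<b , b<c , q∈a , q∈b , q∈c , _) =
    i , j , block , proportional-sym (proj₁ (meet i≢j)) q (proj₂ (meet i≢j)) (meet-unique i≢j p q∈a q∈b)
    where
    i j : Fin (suc n)
    i = inject₁ a
    j = inject₁ b
    i<j : toℕ i < toℕ j
    i<j = subst₂ _<_ (sym (toℕ-inject₁ a)) (sym (toℕ-inject₁ b)) a<b
    i≢j : i ≢ j
    i≢j = <⇒≢ i<j ∘′ cong toℕ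
    c≡i·j : inject₁ c ≡ i · j
    c≡i·j = ∈₃-third (IsThirdLine.only (·-third i≢j) (inject₁ c)
                                         (on-same-point i≢j p (meet-unique i≢j p q∈a q∈b) q∈c))
                     (<⇒≢ (<-trans a<b b<c) ∘′ sym ∘′ cong toℕ ∘′ inject₁-injective)
                     (<⇒≢ b<c ∘′ sym ∘′ cong toℕ ∘′ inject₁-injective)
    block : Block i j
    block = i<j
          , subst₂ _<_ (sym (toℕ-inject₁ b)) (trans (sym (toℕ-inject₁ c)) (cong toℕ c≡i·j)) b<c
          , subst (_< n) (trans (sym (toℕ-inject₁ c)) (cong toℕ c≡i·j)) (toℕ<n c)

  same-block-meet⇒same-block : ∀ {i j i′ j′} (b : Block i j) (b′ : Block i′ j′) →
    SamePoint (meet (block⇒≢ b)) (meet (block⇒≢ b′)) → (i , j) ≡ (i′ , j′)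
  same-block-meet⇒same-block {i} {j} {i′} {j′} b@(i<j , j<t , _) b′@(i′<j′ , j′<t′ , _) same =
    let i≡i′ , j≡j′ = ascending-triples-agree i<j j<t i′<j′ j′<t′
                        (on-other b b′ same (on-meetˡ i′ j′)) (on-other b b′ same (on-meetʳ i′ j′))
                        (on-other b′ b same′ (on-meetˡ i j)) (on-other b′ b same′ (on-meetʳ i j))
    in cong₂ _,_ (toℕ-injective i≡i′) (toℕ-injective j≡j′)
    where
    same′ : SamePoint (meet (block⇒≢ b′)) (meet (block⇒≢ b))
    same′ = proportional-sym (proj₁ (meet (block⇒≢ b))) _ (proj₂ (meet (block⇒≢ b))) same
    on-other : ∀ {x y x′ y′ m} (b : Block x y) (b′ : Block x′ y′) →
               SamePoint (meet (block⇒≢ b)) (meet (block⇒≢ b′)) →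
               OnMeet x′ y′ m → toℕ m ∈₃ (toℕ x , toℕ y , toℕ (x · y))
    on-other {m = m} b b′ same on-m = ∈₃-map toℕ (IsThirdLine.only (·-third (block⇒≢ b)) m
                                        (on-same-point (block⇒≢ b) (meet (block⇒≢ b′)) same on-m))

  deleteLast-hasT3 : HasT3 (deleteLast A) blocks
  deleteLast-hasT3 = points , distinct-points , (λ k → block-meet-triple (sound k)) , all-found
    where
    open Enumeration (enumerate₂ λ i j → Ascending? (toℕ i) (toℕ j) (toℕ (i · j)))
    points : Fin blocks → Point
    points k = meet (block⇒≢ (sound k))
    distinct-points : ∀ k l → k ≢ l → ¬ SamePoint (points k) (points l)
    distinct-points k l k≢l same = k≢l (injective k l (same-block-meet⇒same-block (sound k) (sound l) same))
    all-found : ∀ p → TriplePoint (deleteLast A) p → ∃ λ k → SamePoint p (points k)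
    all-found p triple =
      let i , j , b , p~meet = triple-point⇒block p triple
          k , index-k≡ij     = complete (i , j) b
      in k , subst (λ (i , j) → Proportional (proj₁ p) (cross (coords i) (coords j)))
                   (sym index-k≡ij) p~meet

  deleteLast-attains-U3 : HasT3 (deleteLast A) (U3 n)
  deleteLast-attains-U3 =
    subst (HasT3 (deleteLast A)) (6*X≡n*[n∸2]⇒X≡U3 n blocks 6*blocks≡n*[n∸2]) deleteLast-hasT3

no-triple-points : ∀ {c ℓ} {F : Field c ℓ} {n} → n ≤ 2 → (B : Arrangement F n) → HasT3 B 0
no-triple-points n≤2 B = (λ ()) , (λ ()) , (λ ()) , λ { _ (a , b , c , a<b , b<c , _) →
  contradiction n≤2 (<⇒≱ (≤-<-trans (≤-<-trans (≤-<-trans z≤n a<b) b<c) (toℕ<n c))) }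

U3-small : ∀ {n} → n ≤ 2 → U3 n ≡ 0
U3-small z≤n             = refl
U3-small (s≤s z≤n)       = refl
U3-small (s≤s (s≤s z≤n)) = refl

mainTheorem6 : ∀ {c ℓ} (F : Field c ℓ) (s : ℕ) → 1 ≤ s
    → (A : Arrangement F s) → AllIntersectionsTriple A
    → Σ (Field c ℓ) (λ F' → Σ (Arrangement F' (s ∸ 1)) (λ B → HasT3 B (U3 (s ∸ 1))))
mainTheorem6 F (suc n) _ A all-triple with n ≤? 2
... | yes n≤2 = F , deleteLast A
              , subst (HasT3 (deleteLast A)) (sym (U3-small n≤2)) (no-triple-points n≤2 (deleteLast A))
... | no n≰2  = F , deleteLast A , Deletion.deleteLast-attains-U3 A all-triple (s≤s (≰⇒> n≰2))
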